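{- Let $(G,c,k)$ be an instance of \textsc{Multi-STC}, let $A\subseteq\mathscr{P}$ be a periphery component and let $L$ be an STC-labeling of $G$. Then there exists an STC-labeling $L'$ of $G$ that is partially equal to $L$ on $E\setminus E(A)$ and satisfies $|W_{L'}\cap E(A)|\le 1$.
   Context: A $c$-colored labeling of $G=(V,E)$ is a partition $L=(S^1_L,\dots,S^c_L,W_L)$ of $E$; it is an STC-labeling if there are no $\{u,v\},\{v,w\}\in S^i_L$ ($u\ne w$) with $\{u,w\}\notin E$. Fix $D\subseteq E$ such that $(V,E\setminus D)$ has maximum degree at most $\lfloor c/2\rfloor+1$; the core $\mathscr{C}$ is the set of vertices incident with an edge of $D$, $\mathscr{P}=V\setminus\mathscr{C}$, and a periphery component is the vertex set of a connected component of $G[\mathscr{P}]$. $E(A)$ denotes edges with both endpoints in $A$. Labelings $L,L'$ are partially equal on $E'$ if for all $e\in E'$ and all $i$, $e\in S^i_L\iff e\in S^i_{L'}$. -}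

module Defs where

open import Data.Nat using (ℕ; zero; suc; _+_; _≤_; _/_)
open import Data.Bool using (Bool; true; false; _∧_; not; if_then_else_)
open import Data.Fin using (Fin)
import Data.Fin as Fin
open import Data.Maybe using (Maybe; just; nothing)
open import Data.Product using (Σ; _×_; _,_; ∃)
open import Data.Sum using (_⊎_)
open import Relation.Nullary using (¬_)
open import Relation.Binary.PropositionalEquality using (_≡_; _≢_)

record Graph (n : ℕ) : Set where
  field
    adj   : Fin n → Fin n → Bool
    sym   : ∀ u v → adj u v ≡ adj v u
    irref : ∀ v → adj v v ≡ false

open Graph public

Edge : ∀ {n} → Graph n → Fin n → Fin n → Set
Edge G u v = adj G u v ≡ true

countF : ∀ {n} → (Fin n → Bool) → ℕ
countF {zero}  f = 0
countF {suc n} f = (if f Fin.zero then 1 else 0) + countF (λ i → f (Fin.suc i))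

-- A c-colored labeling: each edge {u,v} gets  just i  (edge in S^i_L)
-- or  nothing  (edge in W_L).  The label is symmetric so it is a function of
-- the unordered edge; values on non-edges are irrelevant (never inspected).
record Labeling {n : ℕ} (G : Graph n) (c : ℕ) : Set where
  field
    lab     : Fin n → Fin n → Maybe (Fin c)
    lab-sym : ∀ u v → lab u v ≡ lab v u

open Labeling public

IsSTC : ∀ {n c} {G : Graph n} → Labeling G c → Set
IsSTC {n} {c} {G} L =
  ∀ (u v w : Fin n) (i : Fin c) → u ≢ w →
  Edge G u v → Edge G v w →
  lab L u v ≡ just i → lab L v w ≡ just i → Edge G u w

record DeletionSet {n : ℕ} (G : Graph n) (c : ℕ) : Set where
  field
    inD    : Fin n → Fin n → Bool
    D-sym  : ∀ u v → inD u v ≡ inD v u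
    D⊆E    : ∀ u v → inD u v ≡ true → Edge G u v
    degree : ∀ v → countF (λ u → adj G v u ∧ not (inD v u)) ≤ c / 2 + 1

open DeletionSet public

Core : ∀ {n c} {G : Graph n} → DeletionSet G c → Fin n → Set
Core D v = ∃ λ u → inD D v u ≡ true

Periphery : ∀ {n c} {G : Graph n} → DeletionSet G c → Fin n → Set
Periphery D v = ¬ Core D v

data ReachIn {n : ℕ} (G : Graph n) (P : Fin n → Set) (a : Fin n) : Fin n → Set where
  here : P a → ReachIn G P a a
  step : ∀ {u v} → ReachIn G P a u → Edge G u v → P v → ReachIn G P a v

IsPeripheryComponent : ∀ {n c} {G : Graph n} → DeletionSet G c → (Fin n → Set) → Set
IsPeripheryComponent {n} {c} {G} D A =
  Σ (Fin n) λ a → Periphery D a ×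
    (∀ v → (A v → ReachIn G (Periphery D) a v) × (ReachIn G (Periphery D) a v → A v))

PartiallyEqualOutside : ∀ {n c} {G : Graph n} → (Fin n → Set) → Labeling G c → Labeling G c → Set
PartiallyEqualOutside {n} {c} {G} A L L' =
  ∀ (u v : Fin n) → Edge G u v → ¬ (A u × A v) →
  ∀ (i : Fin c) → (lab L u v ≡ just i → lab L' u v ≡ just i) × (lab L' u v ≡ just i → lab L u v ≡ just i)

AtMostOneWeakIn : ∀ {n c} {G : Graph n} → (Fin n → Set) → Labeling G c → Set
AtMostOneWeakIn {n} {c} {G} A L =
  ∀ (u v x y : Fin n) →
  Edge G u v → A u → A v → lab L u v ≡ nothing →
  Edge G x y → A x → A y → lab L x y ≡ nothing →
  (u ≡ x × v ≡ y) ⊎ (u ≡ y × v ≡ x)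

module Submission where

-- No vertex of A is incident with D, so every vertex of A has degree
-- at most h + 1 with h = ⌊c/2⌋.  If an edge {u,v} of E(A) is weak and u has
-- a second weak edge, then the strong edges at u and v other than {u,v} use
-- at most (h - 1) + h < c colours, so {u,v} can be given a colour unused at
-- both endpoints, which keeps the labeling STC.  To always have such a second
-- weak edge we rank the edges of E(A) by their distance to a fixed vertex a
-- of A (one root edge at a gets rank 0), make all of E(A) weak, and then
-- repeatedly recolour a weak edge of maximal positive rank: its "parent" edge
-- has smaller rank and is therefore still weak.  When no weak edge of
-- positive rank remains, only the root edge can be weak.

open import Algebra.Properties.CommutativeSemigroup using (interchange)
open import Data.Bool using (Bool; true; false; _∧_; _∨_; not; if_then_else_)
open import Data.Bool.Properties using (∧-comm; ∨-comm; ∧-identityʳ; ∧-zeroʳ; not-injective)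
open import Data.Empty using (⊥-elim)
open import Data.Fin using (Fin; zero; suc; _≟_)
open import Data.List using (List; []; _∷_; allFin; cartesianProduct; filter)
open import Data.List.Extrema.Nat using (argmax; argmax-all; f[xs]≤f[argmax])
open import Data.List.Membership.Propositional using (_∈_)
open import Data.List.Membership.Propositional.Properties
  using (∈-allFin; ∈-cartesianProduct⁺; ∈-filter⁺)
open import Data.List.Relation.Unary.All using (lookup)
open import Data.List.Relation.Unary.All.Properties using (all-filter)
open import Data.List.Relation.Unary.Any using (here; there)
open import Data.Maybe using (Maybe; just; nothing; is-just; is-nothing)
open import Data.Nat using (ℕ; zero; suc; _+_; _≤_; _<_; z≤n; s≤s; _/_; _⊓_; _≤′_; ≤′-reflexive; ≤′-step)
open import Data.Nat.DivMod using (m/n*n≤m)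
open import Data.Nat.Properties
  using ( ≤-refl; ≤-trans; ≤-pred; ≤-total; <-irrefl; ≤-<-trans; <-≤-trans; ≮⇒≥; n≤1+n
        ; +-mono-≤; +-suc; +-comm; +-identityʳ; *-comm; ⊓-comm; m⊓n≤n; m≤n⇒m⊓n≡m
        ; ≤⇒≤′; n≤0⇒n≡0; +-commutativeSemigroup)
import Data.Bool as Bool
open import Data.Product using (Σ; _×_; _,_; ∃; proj₁; proj₂)
open import Data.Sum using (_⊎_; inj₁; inj₂)
open import Relation.Nullary using (¬_; Dec; yes; no; does)
open import Relation.Nullary.Decidable using (dec-true; dec-false; _×-dec_; _⊎-dec_)
open import Relation.Binary.PropositionalEquality
  using (_≡_; _≢_; refl; cong; cong₂; subst; trans) renaming (sym to ≡-sym)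
open import Defs hiding (sym)

∧-true : ∀ {a b} → a ∧ b ≡ true → a ≡ true × b ≡ true
∧-true {true} {true} _ = refl , refl

∨-false : ∀ {a b} → a ∨ b ≡ false → a ≡ false × b ≡ false
∨-false {false} {false} _ = refl , refl

∨-right : ∀ {a b} → a ≡ false → a ∨ b ≡ true → b ≡ true
∨-right refl p = p

∨-introʳ : ∀ a {b} → b ≡ true → a ∨ b ≡ true
∨-introʳ true _ = refl
∨-introʳ false p = p

true≢false : true ≢ false
true≢false ()

_==_ : ∀ {m} → Fin m → Fin m → Bool
x == y = does (x ≟ y)

==-refl : ∀ {m} (x : Fin m) → (x == x) ≡ true
==-refl x = dec-true (x ≟ x) refl

==-false : ∀ {m} {x y : Fin m} → x ≢ y → (x == y) ≡ false
==-false {x = x} {y} = dec-false (x ≟ y)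

==-sound : ∀ {m} (x y : Fin m) → (x == y) ≡ true → x ≡ y
==-sound x y p with x ≟ y
... | yes x≡y = x≡y
==-sound x y () | no _

bit : Bool → ℕ
bit b = if b then 1 else 0

bit≤1 : ∀ b → bit b ≤ 1
bit≤1 true = s≤s z≤n
bit≤1 false = z≤n

bit-mono : ∀ {a b} → (a ≡ true → b ≡ true) → bit a ≤ bit b
bit-mono {true} h rewrite h refl = ≤-refl
bit-mono {false} h = z≤n

bit-∨ : ∀ a b → bit (a ∨ b) ≤ bit a + bit b
bit-∨ true b = s≤s z≤n
bit-∨ false b = ≤-refl

countF-ext : ∀ {m} {f g : Fin m → Bool} → (∀ i → f i ≡ g i) → countF f ≡ countF g
countF-ext {zero} h = refl
countF-ext {suc m} h = cong₂ _+_ (cong bit (h zero)) (countF-ext (λ i → h (suc i)))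

countF-false : ∀ m → countF {m} (λ _ → false) ≡ 0
countF-false zero = refl
countF-false (suc m) = countF-false m

countF-≤ : ∀ {m} (f : Fin m → Bool) → countF f ≤ m
countF-≤ {zero} f = z≤n
countF-≤ {suc m} f = +-mono-≤ (bit≤1 (f zero)) (countF-≤ (λ i → f (suc i)))

countF-mono : ∀ {m} {f g : Fin m → Bool} → (∀ i → f i ≡ true → g i ≡ true) → countF f ≤ countF g
countF-mono {zero} h = z≤n
countF-mono {suc m} h = +-mono-≤ (bit-mono (h zero)) (countF-mono (λ i → h (suc i)))

countF-strict : ∀ {m} {f g : Fin m → Bool} → (∀ i → f i ≡ true → g i ≡ true) →
  (j : Fin m) → f j ≡ false → g j ≡ true → suc (countF f) ≤ countF g
countF-strict h zero fj gj rewrite fj | gj = s≤s (countF-mono (λ i → h (suc i)))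
countF-strict {f = f} {g} h (suc j) fj gj =
  subst (_≤ bit (g zero) + countF (λ i → g (suc i))) (+-suc (bit (f zero)) _)
    (+-mono-≤ (bit-mono (h zero)) (countF-strict (λ i → h (suc i)) j fj gj))

countF-∨ : ∀ {m} (f g : Fin m → Bool) → countF (λ i → f i ∨ g i) ≤ countF f + countF g
countF-∨ {zero} f g = z≤n
countF-∨ {suc m} f g =
  subst (bit (f zero ∨ g zero) + countF (λ i → f (suc i) ∨ g (suc i)) ≤_)
    (interchange +-commutativeSemigroup (bit (f zero)) (bit (g zero)) _ _)
    (+-mono-≤ (bit-∨ (f zero) (g zero)) (countF-∨ (λ i → f (suc i)) (λ i → g (suc i))))

countF-missing : ∀ {m} (f : Fin m → Bool) → countF f < m → ∃ λ i → f i ≡ false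
countF-missing {suc m} f lt with f zero in e
... | false = zero , e
... | true with countF-missing (λ i → f (suc i)) (≤-pred lt)
... | i , p = suc i , p

anyF : ∀ {m} → (Fin m → Bool) → Bool
anyF {zero} f = false
anyF {suc m} f = f zero ∨ anyF (λ i → f (suc i))

anyF-intro : ∀ {m} (f : Fin m → Bool) (i : Fin m) → f i ≡ true → anyF f ≡ true
anyF-intro f zero p rewrite p = refl
anyF-intro f (suc i) p = ∨-introʳ (f zero) (anyF-intro (λ j → f (suc j)) i p)

anyF-elim : ∀ {m} (f : Fin m → Bool) → anyF f ≡ true → ∃ λ i → f i ≡ true
anyF-elim {suc m} f p with f zero in e
... | true = zero , e
... | false with anyF-elim (λ j → f (suc j)) p
... | i , q = suc i , q

anyF-none : ∀ {m} (f : Fin m → Bool) → anyF f ≡ false → ∀ i → f i ≡ false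
anyF-none f p i with f i in e
... | false = refl
... | true = ⊥-elim (true≢false (trans (≡-sym (anyF-intro f i e)) p))

holds : ∀ {c} → Maybe (Fin c) → Fin c → Bool
holds nothing i = false
holds (just j) i = j == i

holds-≤1 : ∀ {c} (x : Maybe (Fin c)) → countF (holds x) ≤ bit (is-just x)
holds-≤1 {c} nothing rewrite countF-false c = z≤n
holds-≤1 {suc c} (just zero) rewrite countF-false c = ≤-refl
holds-≤1 (just (suc j)) = holds-≤1 (just j)

image-size : ∀ {m c} (g : Fin m → Maybe (Fin c)) →
  countF {c} (λ i → anyF (λ x → holds (g x) i)) ≤ countF (λ x → is-just (g x))
image-size {zero} {c} g rewrite countF-false c = z≤n
image-size {suc m} g =
  ≤-trans (countF-∨ (holds (g zero)) (λ i → anyF (λ x → holds (g (suc x)) i)))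
    (+-mono-≤ (holds-≤1 (g zero)) (image-size (λ x → g (suc x))))

countL : ∀ {X : Set} → (X → Bool) → List X → ℕ
countL f [] = 0
countL f (x ∷ xs) = bit (f x) + countL f xs

countL-mono : ∀ {X : Set} {f g : X → Bool} → (∀ x → f x ≡ true → g x ≡ true) →
  ∀ xs → countL f xs ≤ countL g xs
countL-mono h [] = z≤n
countL-mono h (x ∷ xs) = +-mono-≤ (bit-mono (h x)) (countL-mono h xs)

countL-strict : ∀ {X : Set} {f g : X → Bool} → (∀ x → f x ≡ true → g x ≡ true) →
  ∀ {x} xs → x ∈ xs → f x ≡ false → g x ≡ true → suc (countL f xs) ≤ countL g xs
countL-strict h (y ∷ xs) (here refl) fx gx rewrite fx | gx = s≤s (countL-mono h xs)
countL-strict {f = f} {g} h (y ∷ xs) (there x∈xs) fx gx =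
  subst (_≤ bit (g y) + countL g xs) (+-suc (bit (f y)) _)
    (+-mono-≤ (bit-mono (h y)) (countL-strict h xs x∈xs fx gx))

heaviest : ∀ {X : Set} (P : X → Bool) (w : X → ℕ) (y : X) → P y ≡ true → (xs : List X) →
  Σ X λ z → P z ≡ true × (∀ x → x ∈ xs → P x ≡ true → w x ≤ w z)
heaviest {X} P w y py xs =
    argmax w y chosen
  , argmax-all w py (all-filter P? xs)
  , λ x x∈xs px → lookup (f[xs]≤f[argmax] y chosen) (∈-filter⁺ P? x∈xs px)
  where
    P? : (x : X) → Dec (P x ≡ true)
    P? x = P x Bool.≟ true
    chosen : List X
    chosen = filter P? xs

-- (2) Recolouring a single edge.

edge-sym : ∀ {n} (G : Graph n) {u v} → Edge G u v → Edge G v u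
edge-sym G {u} {v} e = trans (Graph.sym G v u) e

SameE : ∀ {n} → Fin n → Fin n → Fin n → Fin n → Set
SameE x y u v = (x ≡ u × y ≡ v) ⊎ (x ≡ v × y ≡ u)

sameE? : ∀ {n} (x y u v : Fin n) → Dec (SameE x y u v)
sameE? x y u v = ((x ≟ u) ×-dec (y ≟ v)) ⊎-dec ((x ≟ v) ×-dec (y ≟ u))

SameE-swap : ∀ {n} {x y u v : Fin n} → SameE x y u v → SameE y x u v
SameE-swap (inj₁ (p , q)) = inj₂ (q , p)
SameE-swap (inj₂ (p , q)) = inj₁ (q , p)

SameE-twice : ∀ {n} {x y z u v : Fin n} → SameE x y u v → SameE y z u v → x ≡ z
SameE-twice (inj₁ (refl , refl)) (inj₁ (refl , refl)) = refl
SameE-twice (inj₁ (refl , refl)) (inj₂ (refl , refl)) = refl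
SameE-twice (inj₂ (refl , refl)) (inj₁ (refl , refl)) = refl
SameE-twice (inj₂ (refl , refl)) (inj₂ (refl , refl)) = refl

-- Case distinction on a decision, blocking until the decision is known.
ifDec : ∀ {P X : Set} → Dec P → X → X → X
ifDec (yes _) x y = x
ifDec (no _) x y = y

SameE-via : ∀ {n} {u v x y a b : Fin n} → SameE u v a b → SameE x y a b → SameE u v x y
SameE-via (inj₁ (refl , refl)) (inj₁ (refl , refl)) = inj₁ (refl , refl)
SameE-via (inj₁ (refl , refl)) (inj₂ (refl , refl)) = inj₂ (refl , refl)
SameE-via (inj₂ (refl , refl)) (inj₁ (refl , refl)) = inj₂ (refl , refl)
SameE-via (inj₂ (refl , refl)) (inj₂ (refl , refl)) = inj₁ (refl , refl)

nothing≢just : ∀ {X : Set} {x : X} → nothing ≢ just x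
nothing≢just ()

module _ {n c : ℕ} {G : Graph n} where

  STC-weaken : (L L' : Labeling G c) → (∀ x y i → lab L' x y ≡ just i → lab L x y ≡ just i) →
    IsSTC L → IsSTC L'
  STC-weaken L L' weaker stc x y z i x≢z exy eyz l₁ l₂ =
    stc x y z i x≢z exy eyz (weaker x y i l₁) (weaker y z i l₂)

  recolour : Labeling G c → Fin n → Fin n → Fin c → Labeling G c
  lab (recolour L u v i) x y = ifDec (sameE? x y u v) (just i) (lab L x y)
  lab-sym (recolour L u v i) x y with sameE? x y u v | sameE? y x u v
  ... | yes p | yes q = refl
  ... | yes p | no q = ⊥-elim (q (SameE-swap p))
  ... | no p | yes q = ⊥-elim (p (SameE-swap q))
  ... | no p | no q = lab-sym L x y

  recolour-at : ∀ L u v i x y → SameE x y u v → lab (recolour L u v i) x y ≡ just i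
  recolour-at L u v i x y s with sameE? x y u v
  ... | yes _ = refl
  ... | no ns = ⊥-elim (ns s)

  recolour-off : ∀ L u v i x y → ¬ SameE x y u v → lab (recolour L u v i) x y ≡ lab L x y
  recolour-off L u v i x y ns with sameE? x y u v
  ... | yes s = ⊥-elim (ns s)
  ... | no _ = refl

  FreeAt : Labeling G c → Fin n → Fin n → Fin c → Set
  FreeAt L u v i = ∀ x → Edge G u x → x ≢ v → lab L u x ≢ just i

  -- Giving {u,v} a colour free at both endpoints keeps a labeling STC: a
  -- violating path through the recoloured edge would meet a second edge of
  -- that colour at u or v.
  recolour-STC : ∀ (L : Labeling G c) u v i → IsSTC L → FreeAt L u v i → FreeAt L v u i →
    IsSTC (recolour L u v i)
  recolour-STC L u v i stc freeU freeV x y z j x≢z exy eyz l₁ l₂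
    with sameE? x y u v | sameE? y z u v
  ... | yes p | yes q = ⊥-elim (x≢z (SameE-twice p q))
  ... | no p | no q = stc x y z j x≢z exy eyz l₁ l₂
  ... | yes (inj₁ (refl , refl)) | no q =
        ⊥-elim (freeV z eyz (λ { refl → q (inj₂ (refl , refl)) }) (trans l₂ (≡-sym l₁)))
  ... | yes (inj₂ (refl , refl)) | no q =
        ⊥-elim (freeU z eyz (λ { refl → q (inj₁ (refl , refl)) }) (trans l₂ (≡-sym l₁)))
  ... | no p | yes (inj₁ (refl , refl)) =
        ⊥-elim (freeU x (edge-sym G exy) (λ { refl → p (inj₂ (refl , refl)) })
          (trans (lab-sym L y x) (trans l₁ (≡-sym l₂))))
  ... | no p | yes (inj₂ (refl , refl)) =
        ⊥-elim (freeV x (edge-sym G exy) (λ { refl → p (inj₁ (refl , refl)) })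
          (trans (lab-sym L y x) (trans l₁ (≡-sym l₂))))

-- (3) The free-colour lemma.

-- Arithmetic core: with h = ⌊c/2⌋, at most h - 1 colours at one endpoint
-- and at most h at the other leave a colour unused.
fewer-than-c : ∀ {a b} c → suc (suc a) ≤ c / 2 + 1 → suc b ≤ c / 2 + 1 → a + b < c
fewer-than-c {a} {b} c p q =
  ≤-trans (+-mono-≤ (≤-pred (at-most-suc p)) (≤-pred (at-most-suc q)))
    (subst (_≤ c) (trans (*-comm h 2) (cong (h +_) (+-identityʳ h))) (m/n*n≤m c 2))
  where
    h = c / 2
    at-most-suc : ∀ {x} → x ≤ h + 1 → x ≤ suc h
    at-most-suc {x} = subst (x ≤_) (+-comm h 1)

module FreeColour {n c : ℕ} (G : Graph n) (L : Labeling G c) (u v : Fin n) where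

  other : Fin n → Bool
  other x = adj G u x ∧ not (x == v)

  colourAt : Fin n → Maybe (Fin c)
  colourAt x = if other x then lab L u x else nothing

  strong : Fin n → Bool
  strong x = is-just (colourAt x)

  used : Fin c → Bool
  used i = anyF (λ x → holds (colourAt x) i)

  unused-free : ∀ i → used i ≡ false → FreeAt L u v i
  unused-free i unused x e x≢v l
    with anyF-none (λ x → holds (colourAt x) i) unused x
  ... | h rewrite e | ==-false x≢v | l | ==-refl i = true≢false h

  strong⇒other : ∀ x → strong x ≡ true → other x ≡ true
  strong⇒other x p with other x
  ... | true = refl

  other⇒adj : ∀ x → other x ≡ true → adj G u x ≡ true
  other⇒adj x p = proj₁ (∧-true p)

  other-v : other v ≡ false
  other-v = trans (cong (λ b → adj G u v ∧ not b) (==-refl v)) (∧-zeroʳ (adj G u v))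

  strong-bound : Edge G u v → suc (countF strong) ≤ countF (adj G u)
  strong-bound e = ≤-trans (s≤s (countF-mono strong⇒other)) (countF-strict other⇒adj v other-v e)

  strong-bound-weak : Edge G u v → ∀ q → Edge G u q → q ≢ v → lab L u q ≡ nothing →
    suc (suc (countF strong)) ≤ countF (adj G u)
  strong-bound-weak e q eq q≢v l =
    ≤-trans (s≤s (countF-strict strong⇒other q strong-q other-q))
      (countF-strict other⇒adj v other-v e)
    where
      other-q : other q ≡ true
      other-q = cong₂ _∧_ eq (cong not (==-false q≢v))
      strong-q : strong q ≡ false
      strong-q rewrite other-q | l = refl

  used-bound : countF used ≤ countF strong
  used-bound = image-size colourAt

free-colour : ∀ {n c} (G : Graph n) (L : Labeling G c) {u v} → Edge G u v →
  countF (adj G u) ≤ c / 2 + 1 → countF (adj G v) ≤ c / 2 + 1 →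
  (∃ λ q → Edge G u q × q ≢ v × lab L u q ≡ nothing) →
  Σ (Fin c) λ i → FreeAt L u v i × FreeAt L v u i
free-colour {c = c} G L {u} {v} e degU degV (q , eq , q≢v , l)
  with countF-missing (λ i → U.used i ∨ V.used i) few
  where
    module U = FreeColour G L u v
    module V = FreeColour G L v u
    few : countF (λ i → U.used i ∨ V.used i) < c
    few = ≤-<-trans (≤-trans (countF-∨ U.used V.used) (+-mono-≤ U.used-bound V.used-bound))
            (fewer-than-c c (≤-trans (U.strong-bound-weak e q eq q≢v l) degU)
                            (≤-trans (V.strong-bound (edge-sym G e)) degV))
... | i , unused with ∨-false unused
... | unusedU , unusedV =
  i , FreeColour.unused-free G L u v i unusedU , FreeColour.unused-free G L v u i unusedV

-- (4) Greedy strengthening inside a vertex set A, given by inA.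

module Greedy {n : ℕ} (G : Graph n) (inA : Fin n → Bool) where

  EdgeIn : Fin n → Fin n → Set
  EdgeIn x y = Edge G x y × inA x ≡ true × inA y ≡ true

  Lower : (Fin n → Fin n → ℕ) → Fin n → Fin n → Fin n → Set
  Lower rank x y q = EdgeIn x q × q ≢ y × rank x q < rank x y

  record Ranking : Set where
    field
      rank        : Fin n → Fin n → ℕ
      rank-sym    : ∀ x y → rank x y ≡ rank y x
      descent     : ∀ x y → EdgeIn x y → 0 < rank x y →
                    Σ (Fin n) λ q → Lower rank x y q ⊎ Lower rank y x q
      root-unique : ∀ u v x y → EdgeIn u v → rank u v ≡ 0 → EdgeIn x y → rank x y ≡ 0 →
                    SameE u v x y

  positive : ℕ → Bool
  positive zero = false
  positive (suc _) = true

  module Strengthen {c : ℕ} (deg : ∀ v → inA v ≡ true → countF (adj G v) ≤ c / 2 + 1)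
    (R : Ranking) (L : Labeling G c) (stc : IsSTC L) where

    open Ranking R

    AgreesOutside : Labeling G c → Set
    AgreesOutside L' = ∀ x y → inA x ∧ inA y ≡ false → lab L' x y ≡ lab L x y

    WeakDescent : Labeling G c → Set
    WeakDescent L' = ∀ x y → EdgeIn x y → lab L' x y ≡ nothing → 0 < rank x y →
      Σ (Fin n) λ q → (Lower rank x y q × lab L' x q ≡ nothing) ⊎ (Lower rank y x q × lab L' y q ≡ nothing)

    AtMostOneWeak : Labeling G c → Set
    AtMostOneWeak L' = ∀ u v x y → EdgeIn u v → lab L' u v ≡ nothing → EdgeIn x y → lab L' x y ≡ nothing →
      SameE u v x y

    Invariant : Labeling G c → Set
    Invariant L' = IsSTC L' × AgreesOutside L' × WeakDescent L'

    pending : Labeling G c → Fin n → Fin n → Bool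
    pending L' x y = adj G x y ∧ (inA x ∧ (inA y ∧ (is-nothing (lab L' x y) ∧ positive (rank x y))))

    pending-intro : ∀ L' x y → EdgeIn x y → lab L' x y ≡ nothing → 0 < rank x y → pending L' x y ≡ true
    pending-intro L' x y (e , ax , ay) l pos rewrite e | ax | ay | l with rank x y | pos
    ... | suc _ | _ = refl

    pending-elim : ∀ L' x y → pending L' x y ≡ true → EdgeIn x y × lab L' x y ≡ nothing × 0 < rank x y
    pending-elim L' x y p with ∧-true {adj G x y} p
    ... | e , p₁ with ∧-true {inA x} p₁
    ... | ax , p₂ with ∧-true {inA y} p₂
    ... | ay , _ with lab L' x y | rank x y | ∧-true {is-nothing (lab L' x y)} (proj₂ (∧-true {inA y} p₂))
    ... | just _ | _ | () , _
    ... | nothing | zero | _ , ()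
    ... | nothing | suc _ | _ = (e , ax , ay) , refl , s≤s z≤n

    pending-weak : ∀ L' x y → pending L' x y ≡ true → lab L' x y ≡ nothing
    pending-weak L' x y p = proj₁ (proj₂ (pending-elim L' x y p))

    not-pending⇒root : ∀ L' x y → EdgeIn x y → lab L' x y ≡ nothing → pending L' x y ≡ false → rank x y ≡ 0
    not-pending⇒root L' x y exy l np =
      n≤0⇒n≡0 (≮⇒≥ (λ pos → true≢false (trans (≡-sym (pending-intro L' x y exy l pos)) np)))

    pairs : List (Fin n × Fin n)
    pairs = cartesianProduct (allFin n) (allFin n)

    ∈-pairs : ∀ x y → (x , y) ∈ pairs
    ∈-pairs x y = ∈-cartesianProduct⁺ (∈-allFin x) (∈-allFin y)

    pendingCount : Labeling G c → ℕ
    pendingCount L' = countL (λ p → pending L' (proj₁ p) (proj₂ p)) pairs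

    allWeak : Labeling G c
    lab allWeak x y = if inA x ∧ inA y then nothing else lab L x y
    lab-sym allWeak x y rewrite ∧-comm (inA x) (inA y) | lab-sym L x y = refl

    allWeak-inside : ∀ x y → inA x ≡ true → inA y ≡ true → lab allWeak x y ≡ nothing
    allWeak-inside x y ax ay rewrite ax | ay = refl

    allWeak-weaker : ∀ x y i → lab allWeak x y ≡ just i → lab L x y ≡ just i
    allWeak-weaker x y i p with inA x ∧ inA y
    ... | false = p

    allWeak-invariant : Invariant allWeak
    allWeak-invariant =
        STC-weaken L allWeak allWeak-weaker stc
      , (λ x y outside → cong (if_then nothing else lab L x y) outside)
      , descent-weak
      where
        descent-weak : WeakDescent allWeak
        descent-weak x y exy@(_ , ax , ay) _ pos with descent x y exy pos
        ... | q , inj₁ low@((_ , _ , aq) , _) = q , inj₁ (low , allWeak-inside x q ax aq)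
        ... | q , inj₂ low@((_ , _ , aq) , _) = q , inj₂ (low , allWeak-inside y q ay aq)

    -- One greedy step: recolour a pending edge {u,v} of maximal rank with a
    -- colour free at both ends; its weak lower neighbour makes this possible.
    module Step (L' : Labeling G c) (inv : Invariant L') (u v : Fin n)
      (puv : pending L' u v ≡ true)
      (maximal : ∀ x y → pending L' x y ≡ true → rank x y ≤ rank u v) where

      uv∈A : EdgeIn u v
      uv∈A = proj₁ (pending-elim L' u v puv)

      au : inA u ≡ true
      au = proj₁ (proj₂ uv∈A)

      av : inA v ≡ true
      av = proj₂ (proj₂ uv∈A)

      colour : Σ (Fin c) λ i → FreeAt L' u v i × FreeAt L' v u i
      colour with proj₂ (proj₂ inv) u v uv∈A (pending-weak L' u v puv) (proj₂ (proj₂ (pending-elim L' u v puv)))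
      ... | q , inj₁ (((eq , _) , q≢v , _) , l) =
            free-colour G L' (proj₁ uv∈A) (deg u au) (deg v av) (q , eq , q≢v , l)
      ... | q , inj₂ (((eq , _) , q≢u , _) , l)
        with free-colour G L' (edge-sym G (proj₁ uv∈A)) (deg v av) (deg u au) (q , eq , q≢u , l)
      ... | i , freeV , freeU = i , freeU , freeV

      i : Fin c
      i = proj₁ colour

      next : Labeling G c
      next = recolour L' u v i

      inside : ∀ {x y} → SameE x y u v → inA x ∧ inA y ≡ true
      inside (inj₁ (refl , refl)) rewrite au | av = refl
      inside (inj₂ (refl , refl)) rewrite au | av = refl

      weak⇒not-uv : ∀ x y → lab next x y ≡ nothing → ¬ SameE x y u v
      weak⇒not-uv x y l s = nothing≢just (trans (≡-sym l) (recolour-at L' u v i x y s))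

      weak-before : ∀ x y → lab next x y ≡ nothing → lab L' x y ≡ nothing
      weak-before x y l = trans (≡-sym (recolour-off L' u v i x y (weak⇒not-uv x y l))) l

      below-uv : ∀ x y → EdgeIn x y → lab next x y ≡ nothing → 0 < rank x y → rank x y ≤ rank u v
      below-uv x y exy l pos = maximal x y (pending-intro L' x y exy (weak-before x y l) pos)

      rank-SameE : ∀ {x y} → SameE x y u v → rank x y ≡ rank u v
      rank-SameE (inj₁ (refl , refl)) = refl
      rank-SameE {x} {y} (inj₂ (refl , refl)) = rank-sym x y

      -- A lower neighbour of a pending edge lies strictly below rank(u,v), so
      -- it is not {u,v} and keeps its label.
      lower-kept : ∀ s t q → rank s t ≤ rank u v → rank s q < rank s t →
        lab next s q ≡ lab L' s q
      lower-kept s t q le lt = recolour-off L' u v i s q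
        (λ same → <-irrefl (rank-SameE same) (<-≤-trans lt le))

      descent-kept : WeakDescent next
      descent-kept x y exy l pos with proj₂ (proj₂ inv) x y exy (weak-before x y l) pos
      ... | q , inj₁ (low@(_ , _ , lt) , lq) =
            q , inj₁ (low , trans (lower-kept x y q (below-uv x y exy l pos) lt) lq)
      ... | q , inj₂ (low@(_ , _ , lt) , lq) =
            q , inj₂ (low , trans (lower-kept y x q (subst (_≤ rank u v) (rank-sym x y) (below-uv x y exy l pos)) lt) lq)

      invariant : Invariant next
      invariant =
          recolour-STC L' u v i (proj₁ inv) (proj₁ (proj₂ colour)) (proj₂ (proj₂ colour))
        , (λ x y outside → trans (recolour-off L' u v i x y
              (λ s → true≢false (trans (≡-sym (inside s)) outside))) (proj₁ (proj₂ inv) x y outside))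
        , descent-kept

      decreases : suc (pendingCount next) ≤ pendingCount L'
      decreases = countL-strict still-pending pairs (∈-pairs u v) uv-done puv
        where
          still-pending : ∀ p → pending next (proj₁ p) (proj₂ p) ≡ true → pending L' (proj₁ p) (proj₂ p) ≡ true
          still-pending (x , y) p with pending-elim next x y p
          ... | exy , l , pos = pending-intro L' x y exy (weak-before x y l) pos
          uv-done : pending next u v ≡ false
          uv-done with pending next u v in p
          ... | false = refl
          ... | true = ⊥-elim (weak⇒not-uv u v (pending-weak next u v p) (inj₁ (refl , refl)))

    greedy-step : ∀ L' → Invariant L' → ∀ u v → pending L' u v ≡ true →
      (∀ x y → pending L' x y ≡ true → rank x y ≤ rank u v) →
      Σ (Labeling G c) λ L'' → Invariant L'' × suc (pendingCount L'') ≤ pendingCount L'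
    greedy-step L' inv u v puv maximal = next , invariant , decreases
      where open Step L' inv u v puv maximal

    -- Repeat the step while some edge is pending; fuel bounds the pending count.
    iterate : ∀ N L' → Invariant L' → pendingCount L' ≤ N →
      Σ (Labeling G c) λ L'' → Invariant L'' × (∀ x y → pending L'' x y ≡ false)
    iterate N L' inv bound with anyF (λ x → anyF (λ y → pending L' x y)) in some
    ... | false = L' , inv , λ x y →
          anyF-none (λ y → pending L' x y) (anyF-none (λ x → anyF (λ y → pending L' x y)) some x) y
    ... | true with anyF-elim (λ x → anyF (λ y → pending L' x y)) some
    ... | x , some-y with anyF-elim (λ y → pending L' x y) some-y
    ... | y , pxy with heaviest (λ p → pending L' (proj₁ p) (proj₂ p)) (λ p → rank (proj₁ p) (proj₂ p)) (x , y) pxy pairs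
    ... | (u , v) , puv , heaviest-uv with greedy-step L' inv u v puv (λ x y → heaviest-uv (x , y) (∈-pairs x y))
    ... | L'' , inv'' , smaller with N | ≤-trans smaller bound
    ... | suc N' | s≤s bound' = iterate N' L'' inv'' bound'

    strengthen : Σ (Labeling G c) λ L' → IsSTC L' × AgreesOutside L' × AtMostOneWeak L'
    strengthen with iterate _ allWeak allWeak-invariant ≤-refl
    ... | L' , (stc' , outside , _) , none =
          L' , stc' , outside , λ u v x y euv luv exy lxy →
            root-unique u v x y euv (not-pending⇒root L' u v euv luv (none u v))
                                exy (not-pending⇒root L' x y exy lxy (none x y))

-- (5) A periphery component, described by breadth-first layers.

-- The first k ≤ m with f k, or m if there is none below m.
firstTrue : (ℕ → Bool) → ℕ → ℕ
firstTrue f zero = 0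
firstTrue f (suc m) = if f 0 then 0 else suc (firstTrue (λ k → f (suc k)) m)

firstTrue-holds : ∀ (f : ℕ → Bool) m → f m ≡ true → f (firstTrue f m) ≡ true
firstTrue-holds f zero p = p
firstTrue-holds f (suc m) p with f 0 in e
... | true = e
... | false = firstTrue-holds (λ k → f (suc k)) m p

firstTrue-least : ∀ (f : ℕ → Bool) m k → k < firstTrue f m → f k ≡ false
firstTrue-least f (suc m) k lt with f 0 in e
firstTrue-least f (suc m) zero lt | false = e
firstTrue-least f (suc m) (suc k) (s≤s lt) | false = firstTrue-least (λ k → f (suc k)) m k lt

firstTrue-≤ : ∀ (f : ℕ → Bool) m j → f j ≡ true → firstTrue f m ≤ j
firstTrue-≤ f m j p = ≮⇒≥ (λ lt → true≢false (trans (≡-sym p) (firstTrue-least f m j lt)))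

module Component {n c : ℕ} (G : Graph n) (D : DeletionSet G c) (a : Fin n) (aP : Periphery D a) where

  peripheral : Fin n → Bool
  peripheral v = not (anyF (inD D v))

  peripheral-intro : ∀ v → Periphery D v → peripheral v ≡ true
  peripheral-intro v p with anyF (inD D v) in e
  ... | false = refl
  ... | true = ⊥-elim (p (anyF-elim (inD D v) e))

  peripheral-elim : ∀ v → peripheral v ≡ true → Periphery D v
  peripheral-elim v p (u , q) rewrite anyF-intro (inD D v) u q = true≢false (≡-sym p)

  layer : ℕ → Fin n → Bool
  layer zero v = v == a
  layer (suc k) v = layer k v ∨ (peripheral v ∧ anyF (λ u → layer k u ∧ adj G u v))

  layer-step : ∀ k v → layer k v ≡ true → layer (suc k) v ≡ true
  layer-step k v p rewrite p = refl

  layer-mono′ : ∀ {k m} v → k ≤′ m → layer k v ≡ true → layer m v ≡ true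
  layer-mono′ v (≤′-reflexive refl) p = p
  layer-mono′ {m = suc m} v (≤′-step le) p = layer-step m v (layer-mono′ v le p)

  layer-mono : ∀ {k m} v → k ≤ m → layer k v ≡ true → layer m v ≡ true
  layer-mono v le = layer-mono′ v (≤⇒≤′ le)

  reach-periphery : ∀ {v} → ReachIn G (Periphery D) a v → Periphery D v
  reach-periphery (here p) = p
  reach-periphery (step _ _ p) = p

  layer⇒reach : ∀ k v → layer k v ≡ true → ReachIn G (Periphery D) a v
  layer⇒reach zero v p rewrite ==-sound v a p = here aP
  layer⇒reach (suc k) v p with layer k v in e
  ... | true = layer⇒reach k v e
  ... | false with ∧-true {peripheral v} p
  ... | pv , grows with anyF-elim (λ u → layer k u ∧ adj G u v) grows
  ... | u , q with ∧-true {layer k u} q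
  ... | lu , euv = step (layer⇒reach k u lu) euv (peripheral-elim v pv)

  Closed : ℕ → Set
  Closed j = ∀ v → layer (suc j) v ≡ true → layer j v ≡ true

  growth : ∀ k → (Σ ℕ λ j → j ≤ k × Closed j) ⊎ (suc k ≤ countF (layer k))
  growth zero = inj₂ (subst (λ z → suc z ≤ countF (layer 0)) (countF-false n)
      (countF-strict (λ i ()) a refl (==-refl a)))
  growth (suc k) with growth k
  ... | inj₁ (j , le , closed) = inj₁ (j , ≤-trans le (n≤1+n k) , closed)
  ... | inj₂ big with anyF (λ v → layer (suc k) v ∧ not (layer k v)) in new
  ... | false = inj₁ (k , n≤1+n k , closed)
    where
      closed : Closed k
      closed v p with layer k v in e
      ... | true = refl
      ... | false with anyF-none (λ v → layer (suc k) v ∧ not (layer k v)) new v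
      ... | h rewrite p | e = ⊥-elim (true≢false h)
  ... | true with anyF-elim (λ v → layer (suc k) v ∧ not (layer k v)) new
  ... | v , q with ∧-true {layer (suc k) v} q
  ... | in-next , fresh =
        inj₂ (≤-trans (s≤s big) (countF-strict (layer-step k) v (not-injective fresh) in-next))

  inA : Fin n → Bool
  inA = layer n

  reach⇒inA : ∀ v → ReachIn G (Periphery D) a v → inA v ≡ true
  reach⇒inA v r with growth n
  ... | inj₂ big = ⊥-elim (<-irrefl refl (≤-trans big (countF-≤ (layer n))))
  ... | inj₁ (j , le , closed) = layer-mono {j} {n} v le (in-layer r)
    where
      in-layer : ∀ {w} → ReachIn G (Periphery D) a w → layer j w ≡ true
      in-layer (here _) = layer-mono {0} {j} a z≤n (==-refl a)
      in-layer {w} (step {u} r' e pw) = closed w (∨-introʳ (layer j w)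
        (cong₂ _∧_ (peripheral-intro w pw) (anyF-intro (λ u → layer j u ∧ adj G u w) u
          (cong₂ _∧_ (in-layer r') e))))

  inA⇒reach : ∀ v → inA v ≡ true → ReachIn G (Periphery D) a v
  inA⇒reach = layer⇒reach n

  -- Periphery vertices have no D-edges, so their degree in G is bounded.
  inA-degree : ∀ v → inA v ≡ true → countF (adj G v) ≤ c / 2 + 1
  inA-degree v p = subst (_≤ c / 2 + 1) (countF-ext no-D) (degree D v)
    where
      pv = reach-periphery (inA⇒reach v p)
      no-D : ∀ u → adj G v u ∧ not (inD D v u) ≡ adj G v u
      no-D u with inD D v u in e
      ... | false = ∧-identityʳ (adj G v u)
      ... | true = ⊥-elim (pv (u , e))

  dist : Fin n → ℕ
  dist v = firstTrue (λ k → layer k v) n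

  dist-layer : ∀ v → inA v ≡ true → layer (dist v) v ≡ true
  dist-layer v = firstTrue-holds (λ k → layer k v) n

  dist≤n : ∀ v → inA v ≡ true → dist v ≤ n
  dist≤n v = firstTrue-≤ (λ k → layer k v) n n

  dist0 : ∀ v → inA v ≡ true → dist v ≡ 0 → v ≡ a
  dist0 v av d0 = ==-sound v a (subst (λ k → layer k v ≡ true) d0 (dist-layer v av))

  predecessor : ∀ v d → inA v ≡ true → dist v ≡ suc d →
    Σ (Fin n) λ w → Edge G w v × inA w ≡ true × dist w ≤ d
  predecessor v d av dv
    with ∨-right (firstTrue-least (λ k → layer k v) n d (subst (d <_) (≡-sym dv) ≤-refl))
                 (subst (λ k → layer k v ≡ true) dv (dist-layer v av))
  ... | grows with anyF-elim (λ u → layer d u ∧ adj G u v) (proj₂ (∧-true {peripheral v} grows))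
  ... | w , q with ∧-true {layer d w} q
  ... | lw , e = w , e , layer-mono {d} {n} w (≤-trans (n≤1+n d) (subst (_≤ n) dv (dist≤n v av))) lw
                   , firstTrue-≤ (λ k → layer k w) n d lw

  isRoot : Maybe (Fin n) → Fin n → Fin n → Bool
  isRoot nothing u v = false
  isRoot (just b) u v = (u == a ∧ v == b) ∨ (u == b ∧ v == a)

  isRoot-sym : ∀ mb u v → isRoot mb u v ≡ isRoot mb v u
  isRoot-sym nothing u v = refl
  isRoot-sym (just b) u v = trans (∨-comm (u == a ∧ v == b) (u == b ∧ v == a))
    (cong₂ _∨_ (∧-comm (u == b) (v == a)) (∧-comm (u == a) (v == b)))

  isRoot-elim : ∀ b x y → isRoot (just b) x y ≡ true → SameE x y a b
  isRoot-elim b x y p with x == a ∧ y == b in e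
  ... | true = inj₁ (==-sound x a (proj₁ (∧-true e)) , ==-sound y b (proj₂ (∧-true e)))
  ... | false = inj₂ (==-sound x b (proj₁ (∧-true p)) , ==-sound y a (proj₂ (∧-true p)))

  RootOK : Maybe (Fin n) → Set
  RootOK nothing = ∀ b → adj G a b ∧ inA b ≡ false
  RootOK (just b) = Edge G a b × inA b ≡ true

  rootChoice : Σ (Maybe (Fin n)) RootOK
  rootChoice with anyF (λ b → adj G a b ∧ inA b) in e
  ... | false = nothing , anyF-none (λ b → adj G a b ∧ inA b) e
  ... | true with anyF-elim (λ b → adj G a b ∧ inA b) e
  ... | b , q = just b , ∧-true q

  open Greedy G inA using (EdgeIn; Lower; Ranking)

  rank : Maybe (Fin n) → Fin n → Fin n → ℕ
  rank mb u v = if isRoot mb u v then 0 else suc (dist u ⊓ dist v)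

  rank-sym : ∀ mb x y → rank mb x y ≡ rank mb y x
  rank-sym mb x y rewrite isRoot-sym mb x y | ⊓-comm (dist x) (dist y) = refl

  rank≤ : ∀ mb x y → rank mb x y ≤ suc (dist x ⊓ dist y)
  rank≤ mb x y with isRoot mb x y
  ... | true = z≤n
  ... | false = ≤-refl

  rank0 : ∀ mb x y → rank mb x y ≡ 0 → isRoot mb x y ≡ true
  rank0 mb x y p with isRoot mb x y
  ... | true = refl

  rank-pos : ∀ mb x y → 0 < rank mb x y → isRoot mb x y ≡ false
  rank-pos mb x y p with isRoot mb x y
  ... | false = refl

  descend-root : ∀ b → RootOK (just b) → ∀ y → isRoot (just b) a y ≡ false →
    Lower (rank (just b)) a y b
  descend-root b (eb , ab) y notRoot = (eb , reach⇒inA a (here aP) , ab) , b≢y , lt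
    where
      root-ab : isRoot (just b) a b ≡ true
      root-ab rewrite ==-refl a | ==-refl b = refl
      b≢y : b ≢ y
      b≢y refl = true≢false (trans (≡-sym root-ab) notRoot)
      lt : rank (just b) a b < rank (just b) a y
      lt rewrite root-ab | notRoot = s≤s z≤n

  descend-pred : ∀ mb x y d → EdgeIn x y → dist x ≤ dist y → isRoot mb x y ≡ false →
    dist x ≡ suc d → Σ (Fin n) (Lower (rank mb) x y)
  descend-pred mb x y d (e , ax , ay) le notRoot dx with predecessor x d ax dx
  ... | w , ewx , aw , dw = w , (edge-sym G ewx , ax , aw) , w≢y , lt
    where
      w≢y : w ≢ y
      w≢y refl = <-irrefl refl (≤-<-trans (subst (_≤ dist w) dx le) (s≤s dw))
      rank-xy : rank mb x y ≡ suc (dist x ⊓ dist y)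
      rank-xy rewrite notRoot = refl
      dist-w<x : dist w < dist x ⊓ dist y
      dist-w<x = subst (dist w <_) (trans (≡-sym dx) (≡-sym (m≤n⇒m⊓n≡m le))) (s≤s dw)
      lt : rank mb x w < rank mb x y
      lt = subst (rank mb x w <_) (≡-sym rank-xy)
             (≤-<-trans (rank≤ mb x w) (s≤s (≤-<-trans (m⊓n≤n (dist x) (dist w)) dist-w<x)))

  descend-at-a : ∀ mb → RootOK mb → ∀ y → EdgeIn a y → isRoot mb a y ≡ false →
    Σ (Fin n) (Lower (rank mb) a y)
  descend-at-a nothing none y (e , _ , ay) _ = ⊥-elim (true≢false (trans (≡-sym (cong₂ _∧_ e ay)) (none y)))
  descend-at-a (just b) okb y _ notRoot = b , descend-root b okb y notRoot

  descend : ∀ mb → RootOK mb → ∀ x y → EdgeIn x y → dist x ≤ dist y → isRoot mb x y ≡ false →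
    ∀ k → dist x ≡ k → Σ (Fin n) (Lower (rank mb) x y)
  descend mb ok x y exy le notRoot (suc d) dx = descend-pred mb x y d exy le notRoot dx
  descend mb ok x y exy@(_ , ax , _) le notRoot zero dx with dist0 x ax dx
  ... | refl = descend-at-a mb ok y exy notRoot

  root-unique : ∀ mb {u v x y} → isRoot mb u v ≡ true → isRoot mb x y ≡ true → SameE u v x y
  root-unique (just b) {u} {v} {x} {y} ruv rxy = SameE-via (isRoot-elim b u v ruv) (isRoot-elim b x y rxy)

  ranking-for : ∀ mb → RootOK mb → Ranking
  ranking-for mb ok = record
    { rank = rank mb
    ; rank-sym = rank-sym mb
    ; descent = descent
    ; root-unique = λ u v x y euv ru exy rx → root-unique mb (rank0 mb u v ru) (rank0 mb x y rx)
    }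
    where
      descent : ∀ x y → EdgeIn x y → 0 < rank mb x y → Σ (Fin n) λ q → Lower (rank mb) x y q ⊎ Lower (rank mb) y x q
      descent x y exy@(e , ax , ay) pos with ≤-total (dist x) (dist y)
      ... | inj₁ le with descend mb ok x y exy le (rank-pos mb x y pos) _ refl
      ... | q , low = q , inj₁ low
      descent x y (e , ax , ay) pos | inj₂ le
        with descend mb ok y x (edge-sym G e , ay , ax) le (trans (isRoot-sym mb y x) (rank-pos mb x y pos)) _ refl
      ... | q , low = q , inj₂ low

  ranking : Ranking
  ranking = ranking-for (proj₁ rootChoice) (proj₂ rootChoice)

proposition22 : ∀ {n : ℕ} (G : Graph n) (c k : ℕ) (D : DeletionSet G c)
    (A : Fin n → Set) → IsPeripheryComponent D A →
    (L : Labeling G c) → IsSTC L →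
    Σ (Labeling G c) λ L' → IsSTC L' × PartiallyEqualOutside A L L' × AtMostOneWeakIn A L'
proposition22 G c k D A (a , aP , A⇔reach) L stc =
  let L' , stc' , agrees , one-weak = strengthen
  in L' , stc' , partially-equal L' agrees , at-most-one L' one-weak
  where
    open Component G D a aP
    open Greedy G inA using (module Strengthen)
    open Strengthen inA-degree ranking L stc using (strengthen; AgreesOutside; AtMostOneWeak)

    A→inA : ∀ v → A v → inA v ≡ true
    A→inA v av = reach⇒inA v (proj₁ (A⇔reach v) av)

    inA→A : ∀ v → inA v ≡ true → A v
    inA→A v p = proj₂ (A⇔reach v) (inA⇒reach v p)

    outside-A : ∀ u v → ¬ (A u × A v) → inA u ∧ inA v ≡ false
    outside-A u v notBoth with inA u in au | inA v in av
    ... | true | true = ⊥-elim (notBoth (inA→A u au , inA→A v av))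
    ... | true | false = refl
    ... | false | _ = refl

    partially-equal : ∀ L' → AgreesOutside L' → PartiallyEqualOutside A L L'
    partially-equal L' agrees u v _ notBoth i =
      (λ p → trans (agrees u v (outside-A u v notBoth)) p) ,
      (λ p → trans (≡-sym (agrees u v (outside-A u v notBoth))) p)

    at-most-one : ∀ L' → AtMostOneWeak L' → AtMostOneWeakIn A L'
    at-most-one L' one-weak u v x y euv au av luv exy ax ay lxy =
      one-weak u v x y (euv , A→inA u au , A→inA v av) luv (exy , A→inA x ax , A→inA y ay) lxy
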